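{- Let $\mathfrak{A}\in\mathrm{REL}$ be a perfect algebra, let $a$ be an atom of $\mathfrak{A}$, and let $x,y$ be nodes with $x=y$ if and only if $a\le1'$. Let $N=N^a_{xy}$ be the pre-network with node set $\{x,y\}$ and the following edges: $(x,y)$ with label $N(x,y)=a$; if $st(a)\neq0$, the edge $(x,x)$ with label $\mathcal{S}a$; if $end(a)\neq0$, the edge $(y,y)$ with label $\mathcal{E}a$; if $\breve{a}\neq0$, the edge $(y,x)$ with label $\breve{a}$. Then $N$ is a well-defined pre-network (labels assigned to the same edge agree) and $N$ is an $\mathfrak{A}$-network.
   Context: $\mathrm{REL}$ is the class of algebras $\mathfrak{A}=\langle A,+,\cdot,-,0,1,;,\breve{\ },1'\rangle$ (binary $;$, unary converse $x\mapsto\breve{x}$, constant $1'$) satisfying: (Ax1) $\langle A,+,\cdot,-,0,1\rangle$ is a Boolean algebra; (Ax2) $(x\cdot\breve{y})\breve{}=\breve{x}\cdot y$; (Ax3) $(x+y);z=x;z+y;z$ and $x;(y+z)=x;y+x;z$; (Ax4) $1;0=0$ and $0;1=0$; (Ax5) $(\breve{x};y)\cdot z=(\breve{x};(y\cdot(\breve{\breve{x}};z)))\cdot z$ and $(x;\breve{y})\cdot z=((x\cdot(z;\breve{\breve{y}}));\breve{y})\cdot z$; (Ax6) $1';x\le x$ and $x;1'\le x$; (Ax7) $1';1'=1'$; (Ax8) $(-(\breve{1});-(\breve{1}))\cdot 1'=0$; (Ax9) $((x\cdot1');y);z=(x\cdot1');(y;z)$, $(x;(y\cdot1'));z=x;((y\cdot1');z)$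 and $(x;y);(z\cdot1')=x;(y;(z\cdot1'))$. An algebra $\mathfrak{A}\in\mathrm{REL}$ is perfect if it is complete and atomic and its converse and composition operations are completely additive. For an atom $a$, $st(a)=1';a$ and $end(a)=a;1'$; if $st(a)\neq0$, $\mathcal{S}a$ is the unique atom $a^-\le1'$ with $a^-;a=a$; if $end(a)\neq0$, $\mathcal{E}a$ is the unique atom $a^-\le1'$ with $a;a^-=a$ (these exist and are unique in a perfect algebra). An $\mathfrak{A}$-pre-network is a pair $N=(N_1,N_2)$ with $N_1$ a set (the nodes) and $N_2:N_1\times N_1\to At(\mathfrak{A})$ a partial map into the set of atoms; its domain is the set of edges, and $N(x,y)$ denotes the label $N_2(x,y)$. An $\mathfrak{A}$-network is a pre-network such that: (N1) for every edge $(x,y)$: (a) $N(x,y)\le1'\iff x=y$; (b) $st(N(x,y))\neq0\iff(x,x)$ is an edge; (c) $end(N(x,y))\neq0\iff (y,y)$ is an edge; (d) $\breve{N(x,y)}\neq0\iff(y,x)$ is an edge; (N2) for every edge $(x,y)$, if $(y,x)$ is an edge then $N(x,y)\cdot\breve{N(y,x)}\neq0$; (N3) whenever $(x,y),(x,z),(z,y)$ are edges, $N(x,y)\cdot(N(x,z);N(z,y))\neq0$. -}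

module Defs where

open import Level using (Level; _⊔_) renaming (suc to lsuc)
open import Data.Product using (Σ; ∃; _×_; _,_)
open import Data.Sum using (_⊎_)
open import Data.Maybe using (Maybe; just)
open import Relation.Nullary using (¬_)
open import Relation.Unary using (Pred)
open import Relation.Binary.PropositionalEquality using (_≡_; _≢_)
open import Algebra.Lattice.Structures using (IsBooleanAlgebra)
open import Function.Bundles using (_⇔_)

-- Composition ; is written _⨾_, converse is postfix _˘,
-- Boolean zero/one are 0r/1r, the identity constant is 1'.
record RelAlg (ℓ : Level) : Set (lsuc ℓ) where
  infixl 6 _+_
  infixl 7 _·_
  infixl 8 _⨾_
  infix 9 _˘
  infix 9 -_
  field
    Carrier : Set ℓ
    _+_ _·_ _⨾_ : Carrier → Carrier → Carrier
    -_ _˘ : Carrier → Carrier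
    0r 1r 1' : Carrier
  _≤_ : Carrier → Carrier → Set ℓ
  x ≤ y = x + y ≡ y
  infix 4 _≤_
  field
    isBooleanAlgebra : IsBooleanAlgebra _≡_ _+_ _·_ -_ 1r 0r
    ax2 : ∀ x y → (x · y ˘) ˘ ≡ x ˘ · y
    ax3ˡ : ∀ x y z → (x + y) ⨾ z ≡ x ⨾ z + y ⨾ z
    ax3ʳ : ∀ x y z → x ⨾ (y + z) ≡ x ⨾ y + x ⨾ z
    ax4ˡ : 1r ⨾ 0r ≡ 0r
    ax4ʳ : 0r ⨾ 1r ≡ 0r
    ax5ˡ : ∀ x y z → (x ˘ ⨾ y) · z ≡ (x ˘ ⨾ (y · (x ˘ ˘ ⨾ z))) · z
    ax5ʳ : ∀ x y z → (x ⨾ y ˘) · z ≡ ((x · (z ⨾ y ˘ ˘)) ⨾ y ˘) · z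
    ax6ˡ : ∀ x → 1' ⨾ x ≤ x
    ax6ʳ : ∀ x → x ⨾ 1' ≤ x
    ax7 : 1' ⨾ 1' ≡ 1'
    ax8 : ((- (1r ˘)) ⨾ (- (1r ˘))) · 1' ≡ 0r
    ax9a : ∀ x y z → ((x · 1') ⨾ y) ⨾ z ≡ (x · 1') ⨾ (y ⨾ z)
    ax9b : ∀ x y z → (x ⨾ (y · 1')) ⨾ z ≡ x ⨾ ((y · 1') ⨾ z)
    ax9c : ∀ x y z → (x ⨾ y) ⨾ (z · 1') ≡ x ⨾ (y ⨾ (z · 1'))

module Theory {ℓ : Level} (𝔄 : RelAlg ℓ) where
  open RelAlg 𝔄 public

  Atom : Carrier → Set ℓ
  Atom a = a ≢ 0r × (∀ b → b ≤ a → b ≡ 0r ⊎ b ≡ a)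

  IsSup : Pred Carrier ℓ → Carrier → Set ℓ
  IsSup X s = (∀ x → X x → x ≤ s) × (∀ u → (∀ x → X x → x ≤ u) → s ≤ u)

  Img : (Carrier → Carrier) → Pred Carrier ℓ → Pred Carrier ℓ
  Img f X y = ∃ λ x → X x × y ≡ f x

  Complete : Set (lsuc ℓ)
  Complete = ∀ (X : Pred Carrier ℓ) → ∃ λ s → IsSup X s

  Atomic : Set ℓ
  Atomic = ∀ x → x ≢ 0r → ∃ λ b → Atom b × b ≤ x

  CompletelyAdditive : Set (lsuc ℓ)
  CompletelyAdditive =
    (∀ X s → IsSup X s → IsSup (Img _˘ X) (s ˘)) ×
    (∀ X s z → IsSup X s → IsSup (Img (λ x → x ⨾ z) X) (s ⨾ z)) ×
    (∀ X s z → IsSup X s → IsSup (Img (λ x → z ⨾ x) X) (z ⨾ s))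

  Perfect : Set (lsuc ℓ)
  Perfect = Complete × Atomic × CompletelyAdditive

  st end : Carrier → Carrier
  st a = 1' ⨾ a
  end a = a ⨾ 1'

  IsS : Carrier → Carrier → Set ℓ
  IsS a e = Atom e × e ≤ 1' × e ⨾ a ≡ a

  IsE : Carrier → Carrier → Set ℓ
  IsE a e = Atom e × e ≤ 1' × a ⨾ e ≡ a

  -- Pre-networks on a node type V: a partial map V × V ⇀ atoms,
  -- represented by lab : V → V → Maybe Carrier (edges = just-values).
  module _ {V : Set ℓ} (lab : V → V → Maybe Carrier) where

    Edge : V → V → Set ℓ
    Edge u v = ∃ λ l → lab u v ≡ just l

    IsPreNetwork : Set ℓ
    IsPreNetwork = ∀ u v l → lab u v ≡ just l → Atom l

    N1 : Set ℓ
    N1 = ∀ u v l → lab u v ≡ just l →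
           (l ≤ 1' ⇔ u ≡ v) ×
           (st l ≢ 0r ⇔ Edge u u) ×
           (end l ≢ 0r ⇔ Edge v v) ×
           (l ˘ ≢ 0r ⇔ Edge v u)

    N2 : Set ℓ
    N2 = ∀ u v l l' → lab u v ≡ just l → lab v u ≡ just l' → l · l' ˘ ≢ 0r

    N3 : Set ℓ
    N3 = ∀ u v w l m n → lab u v ≡ just l → lab u w ≡ just m →
           lab w v ≡ just n → l · (m ⨾ n) ≢ 0r

    IsNetwork : Set ℓ
    IsNetwork = IsPreNetwork × N1 × N2 × N3

  NSpec : Carrier → {V : Set ℓ} → V → V → V → V → Carrier → Set ℓ
  NSpec a x y u v l =
      (u ≡ x × v ≡ y × l ≡ a)
    ⊎ (st a ≢ 0r × u ≡ x × v ≡ x × IsS a l)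
    ⊎ (end a ≢ 0r × u ≡ y × v ≡ y × IsE a l)
    ⊎ (a ˘ ≢ 0r × u ≡ y × v ≡ x × l ≡ a ˘)

module Submission where

-- Every clause of N^a_{xy} is determined by a alone, and when x = y the atom a is a
-- subidentity, for which 𝒮a = ℰa = a ˘ = a; so the clauses never disagree and the label
-- map exists by unique choice. Subidentity atoms p satisfy p ⨾ p = p, because 1' is the
-- join of the subidentity atoms and composition is completely additive, and p ˘ = p,
-- because Ax8 puts p below 1 ˘. The network conditions then reduce to overlaps such as
-- 𝒮a · (a ⨾ a ˘) ≠ 0, which Ax5 obtains from (𝒮a ⨾ a) · a = a ≠ 0 by moving a across ⨾
-- and conversing it.

open import Defs
open import Level using (Level; Lift) renaming (suc to lsuc)
open import Axiom.ExcludedMiddle using (ExcludedMiddle)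
open import Data.Empty using (⊥; ⊥-elim)
open import Data.Product using (∃; _×_; _,_; proj₁; proj₂; map₂)
open import Data.Sum using (_⊎_; inj₁; inj₂)
open import Data.Maybe using (Maybe; just; nothing)
open import Data.Maybe.Properties using (just-injective)
open import Relation.Nullary using (yes; no)
open import Relation.Unary using (Pred)
open import Relation.Binary.PropositionalEquality
open import Function.Bundles using (_⇔_; mk⇔; Equivalence)
import Function.Properties.Equivalence as ⇔
open import Algebra.Lattice.Bundles using (BooleanAlgebra)
import Algebra.Lattice.Properties.BooleanAlgebra as BooleanAlgebraProperties
import Algebra.Lattice.Properties.Lattice as LatticeProperties
import Relation.Binary.Lattice.Bundles as OrderTheoretic

unique-choice : ∀ {ℓ} → ExcludedMiddle ℓ → {A : Set ℓ} (P : A → Set ℓ) →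
  (∀ {l l'} → P l → P l' → l ≡ l') → ∃ λ (m : Maybe A) → ∀ l → m ≡ just l ⇔ P l
unique-choice em P unique with em {∃ P}
... | yes (l₀ , p₀) = just l₀ , λ l →
  mk⇔ (λ e → subst P (just-injective e) p₀) (λ p → cong just (unique p₀ p))
... | no ∄P = nothing , λ l → mk⇔ (λ ()) (λ p → ⊥-elim (∄P (l , p)))

module BooleanReduct {ℓ : Level} (𝔄 : RelAlg ℓ) where
  open Theory 𝔄
  open ≡-Reasoning

  booleanAlgebra : BooleanAlgebra ℓ ℓ
  booleanAlgebra = record
    { Carrier = Carrier ; _≈_ = _≡_ ; _∨_ = _+_ ; _∧_ = _·_ ; ¬_ = -_
    ; ⊤ = 1r ; ⊥ = 0r ; isBooleanAlgebra = isBooleanAlgebra }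

  open BooleanAlgebra booleanAlgebra public
    using ( ∧-comm; ∨-comm; ∧-absorbs-∨; ∨-absorbs-∧; ∧-distribˡ-∨
          ; ∧-complementʳ; ∨-complementʳ )
  open BooleanAlgebraProperties booleanAlgebra public
    using (∧-zeroˡ; ∧-zeroʳ; ∧-identityˡ; ∧-identityʳ; ∨-identityʳ; ¬-involutive)

  -- The library orders a lattice by x ≈ x ∧ y; RelAlg uses x + y ≡ y.
  private
    module ≼ = OrderTheoretic.Lattice
      (LatticeProperties.∨-∧-orderTheoreticLattice (BooleanAlgebra.lattice booleanAlgebra))

  ≤⇒≼ : ∀ {x y} → x ≤ y → x ≡ x · y
  ≤⇒≼ {x} {y} x+y≡y = begin
    x            ≡⟨ sym (∧-absorbs-∨ x y) ⟩
    x · (x + y)  ≡⟨ cong (x ·_) x+y≡y ⟩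
    x · y        ∎

  ≼⇒≤ : ∀ {x y} → x ≡ x · y → x ≤ y
  ≼⇒≤ {x} {y} x≡x·y = begin
    x + y      ≡⟨ cong (_+ y) x≡x·y ⟩
    x · y + y  ≡⟨ ∨-comm (x · y) y ⟩
    y + x · y  ≡⟨ cong (y +_) (∧-comm x y) ⟩
    y + y · x  ≡⟨ ∨-absorbs-∧ y x ⟩
    y          ∎

  ≤-refl : ∀ {x} → x ≤ x
  ≤-refl = ≼⇒≤ ≼.refl

  ≤-trans : ∀ {x y z} → x ≤ y → y ≤ z → x ≤ z
  ≤-trans p q = ≼⇒≤ (≼.trans (≤⇒≼ p) (≤⇒≼ q))

  ≤-antisym : ∀ {x y} → x ≤ y → y ≤ x → x ≡ y
  ≤-antisym p q = ≼.antisym (≤⇒≼ p) (≤⇒≼ q)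

  x·y≤x : ∀ x y → x · y ≤ x
  x·y≤x x y = ≼⇒≤ (≼.x∧y≤x x y)

  x·y≤y : ∀ x y → x · y ≤ y
  x·y≤y x y = ≼⇒≤ (≼.x∧y≤y x y)

  ·-greatest : ∀ {x y z} → x ≤ y → x ≤ z → x ≤ y · z
  ·-greatest p q = ≼⇒≤ (≼.∧-greatest (≤⇒≼ p) (≤⇒≼ q))

  ·-monoʳ : ∀ {x y} z → x ≤ y → z · x ≤ z · y
  ·-monoʳ {x} z p = ·-greatest (x·y≤x z x) (≤-trans (x·y≤y z x) p)

  0≤x : ∀ x → 0r ≤ x
  0≤x x = ≼⇒≤ (sym (∧-zeroˡ x))

  x≤1 : ∀ x → x ≤ 1r
  x≤1 x = ≼⇒≤ (sym (∧-identityʳ x))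

  x≤0⇒x≡0 : ∀ {x} → x ≤ 0r → x ≡ 0r
  x≤0⇒x≡0 {x} p = trans (≤⇒≼ p) (∧-zeroʳ x)

  x·-y≡0⇒x≤y : ∀ {x y} → x · (- y) ≡ 0r → x ≤ y
  x·-y≡0⇒x≤y {x} {y} x·-y≡0 = ≼⇒≤ (begin
    x                  ≡⟨ sym (∧-identityʳ x) ⟩
    x · 1r             ≡⟨ cong (x ·_) (sym (∨-complementʳ y)) ⟩
    x · (y + - y)      ≡⟨ ∧-distribˡ-∨ x y (- y) ⟩
    x · y + x · (- y)  ≡⟨ cong (x · y +_) x·-y≡0 ⟩
    x · y + 0r         ≡⟨ ∨-identityʳ (x · y) ⟩
    x · y              ∎)

  x·y≡0⇒x≤-y : ∀ {x y} → x · y ≡ 0r → x ≤ - y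
  x·y≡0⇒x≤-y {x} {y} x·y≡0 = x·-y≡0⇒x≤y (trans (cong (x ·_) (¬-involutive y)) x·y≡0)

  x≤y⇒x≤-y⇒x≡0 : ∀ {x y} → x ≤ y → x ≤ - y → x ≡ 0r
  x≤y⇒x≤-y⇒x≡0 {x} {y} p q = x≤0⇒x≡0 (subst (x ≤_) (∧-complementʳ y) (·-greatest p q))

  ≢0-mono : ∀ {x y} → x ≢ 0r → x ≤ y → y ≢ 0r
  ≢0-mono {x} x≢0 p y≡0 = x≢0 (x≤0⇒x≡0 (subst (x ≤_) y≡0 p))

  Meets : Carrier → Carrier → Set ℓ
  Meets x y = x · y ≢ 0r

  Meets-sym : ∀ {x y} → Meets x y → Meets y x
  Meets-sym {x} {y} m y·x≡0 = m (trans (∧-comm x y) y·x≡0)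

  Meets-monoʳ : ∀ {x y z} → Meets x y → y ≤ z → Meets x z
  Meets-monoʳ {x} m p = ≢0-mono m (·-monoʳ x p)

  Meets⇒≢0 : ∀ {x y} → Meets x y → y ≢ 0r
  Meets⇒≢0 {x} m y≡0 = m (trans (cong (x ·_) y≡0) (∧-zeroʳ x))

  ≤⇒Meets : ∀ {x y} → x ≢ 0r → x ≤ y → Meets x y
  ≤⇒Meets x≢0 p x·y≡0 = x≢0 (trans (≤⇒≼ p) x·y≡0)

  Meets-refl : ∀ {x} → x ≢ 0r → Meets x x
  Meets-refl x≢0 = ≤⇒Meets x≢0 ≤-refl

  Atom-disjoint⊎≤ : ∀ {b} → Atom b → ∀ x → b · x ≡ 0r ⊎ b ≤ x
  Atom-disjoint⊎≤ {b} (_ , below) x with below (b · x) (x·y≤x b x)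
  ... | inj₁ b·x≡0 = inj₁ b·x≡0
  ... | inj₂ b·x≡b = inj₂ (≼⇒≤ (sym b·x≡b))

  Atom-Meets⇒≤ : ∀ {b x} → Atom b → Meets b x → b ≤ x
  Atom-Meets⇒≤ {x = x} atb m with Atom-disjoint⊎≤ atb x
  ... | inj₁ b·x≡0 = ⊥-elim (m b·x≡0)
  ... | inj₂ b≤x = b≤x

  Atom-≢0-≤⇒≡ : ∀ {a b} → Atom a → b ≢ 0r → b ≤ a → b ≡ a
  Atom-≢0-≤⇒≡ (_ , below) b≢0 b≤a with below _ b≤a
  ... | inj₁ b≡0 = ⊥-elim (b≢0 b≡0)
  ... | inj₂ b≡a = b≡a

  Atom-Meets⇒≡ : ∀ {a b} → Atom a → Atom b → Meets a b → a ≡ b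
  Atom-Meets⇒≡ ata atb m = Atom-≢0-≤⇒≡ atb (proj₁ ata) (Atom-Meets⇒≤ ata m)

module RelAlgProperties {ℓ : Level} (𝔄 : RelAlg ℓ) where
  open Theory 𝔄
  open BooleanReduct 𝔄
  open ≡-Reasoning

  ⨾-monoˡ : ∀ {x y} z → x ≤ y → x ⨾ z ≤ y ⨾ z
  ⨾-monoˡ {x} {y} z p = trans (sym (ax3ˡ x y z)) (cong (_⨾ z) p)

  ⨾-monoʳ : ∀ {x y} z → x ≤ y → z ⨾ x ≤ z ⨾ y
  ⨾-monoʳ {x} {y} z p = trans (sym (ax3ʳ z x y)) (cong (z ⨾_) p)

  ⨾-zeroʳ : ∀ x → x ⨾ 0r ≡ 0r
  ⨾-zeroʳ x = x≤0⇒x≡0 (subst (x ⨾ 0r ≤_) ax4ˡ (⨾-monoˡ 0r (x≤1 x)))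

  ⨾-zeroˡ : ∀ x → 0r ⨾ x ≡ 0r
  ⨾-zeroˡ x = x≤0⇒x≡0 (subst (0r ⨾ x ≤_) ax4ʳ (⨾-monoʳ 0r (x≤1 x)))

  subid-⨾ˡ : ∀ {e} x → e ≤ 1' → e ⨾ x ≤ x
  subid-⨾ˡ x e≤1' = ≤-trans (⨾-monoˡ x e≤1') (ax6ˡ x)

  subid-⨾ʳ : ∀ {e} x → e ≤ 1' → x ⨾ e ≤ x
  subid-⨾ʳ x e≤1' = ≤-trans (⨾-monoʳ x e≤1') (ax6ʳ x)

  ⨾-assoc-subidˡ : ∀ {e} y z → e ≤ 1' → (e ⨾ y) ⨾ z ≡ e ⨾ (y ⨾ z)
  ⨾-assoc-subidˡ y z e≤1' =
    subst (λ t → (t ⨾ y) ⨾ z ≡ t ⨾ (y ⨾ z)) (sym (≤⇒≼ e≤1')) (ax9a _ y z)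

  ⨾-assoc-subidʳ : ∀ {e} x y → e ≤ 1' → (x ⨾ y) ⨾ e ≡ x ⨾ (y ⨾ e)
  ⨾-assoc-subidʳ x y e≤1' =
    subst (λ t → (x ⨾ y) ⨾ t ≡ x ⨾ (y ⨾ t)) (sym (≤⇒≼ e≤1')) (ax9c x y _)

  subid-⨾≤· : ∀ {e e'} → e ≤ 1' → e' ≤ 1' → e ⨾ e' ≤ e · e'
  subid-⨾≤· e≤1' e'≤1' = ·-greatest (subid-⨾ʳ _ e'≤1') (subid-⨾ˡ _ e≤1')

  subid-disjoint⇒⨾≡0 : ∀ {e e'} → e ≤ 1' → e' ≤ 1' → e · e' ≡ 0r → e ⨾ e' ≡ 0r
  subid-disjoint⇒⨾≡0 {e} {e'} e≤1' e'≤1' e·e'≡0 =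
    x≤0⇒x≡0 (subst (e ⨾ e' ≤_) e·e'≡0 (subid-⨾≤· e≤1' e'≤1'))

  Meets-⨾ˡ : ∀ {c y z} → c ˘ ˘ ≡ c → Meets (c ⨾ y) z → Meets y (c ˘ ⨾ z)
  Meets-⨾ˡ {c} {y} {z} c˘˘≡c m y·c˘⨾z≡0 = m (begin
    (c ⨾ y) · z                        ≡⟨ cong (λ t → (t ⨾ y) · z) (sym c˘˘≡c) ⟩
    (c ˘ ˘ ⨾ y) · z                    ≡⟨ ax5ˡ (c ˘) y z ⟩
    (c ˘ ˘ ⨾ (y · (c ˘ ˘ ˘ ⨾ z))) · z  ≡⟨ cong (λ t → (c ˘ ˘ ⨾ (y · (t ⨾ z))) · z) (cong _˘ c˘˘≡c) ⟩
    (c ˘ ˘ ⨾ (y · (c ˘ ⨾ z))) · z      ≡⟨ cong (λ t → (c ˘ ˘ ⨾ t) · z) y·c˘⨾z≡0 ⟩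
    (c ˘ ˘ ⨾ 0r) · z                   ≡⟨ cong (_· z) (⨾-zeroʳ (c ˘ ˘)) ⟩
    0r · z                             ≡⟨ ∧-zeroˡ z ⟩
    0r                                 ∎)

  Meets-⨾ʳ : ∀ {x c z} → c ˘ ˘ ≡ c → Meets (x ⨾ c) z → Meets x (z ⨾ c ˘)
  Meets-⨾ʳ {x} {c} {z} c˘˘≡c m x·z⨾c˘≡0 = m (begin
    (x ⨾ c) · z                        ≡⟨ cong (λ t → (x ⨾ t) · z) (sym c˘˘≡c) ⟩
    (x ⨾ c ˘ ˘) · z                    ≡⟨ ax5ʳ x (c ˘) z ⟩
    ((x · (z ⨾ c ˘ ˘ ˘)) ⨾ c ˘ ˘) · z  ≡⟨ cong (λ t → ((x · (z ⨾ t)) ⨾ c ˘ ˘) · z) (cong _˘ c˘˘≡c) ⟩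
    ((x · (z ⨾ c ˘)) ⨾ c ˘ ˘) · z      ≡⟨ cong (λ t → (t ⨾ c ˘ ˘) · z) x·z⨾c˘≡0 ⟩
    (0r ⨾ c ˘ ˘) · z                   ≡⟨ cong (_· z) (⨾-zeroˡ (c ˘ ˘)) ⟩
    0r · z                             ≡⟨ ∧-zeroˡ z ⟩
    0r                                 ∎)

  module _ {a} (a≢0 : a ≢ 0r) (a˘˘≡a : a ˘ ˘ ≡ a) where

    S-meets-a⨾a˘ : ∀ {s} → IsS a s → Meets s (a ⨾ a ˘)
    S-meets-a⨾a˘ (_ , _ , s⨾a≡a) =
      Meets-⨾ʳ a˘˘≡a (subst (λ t → Meets t a) (sym s⨾a≡a) (Meets-refl a≢0))

    E-meets-a˘⨾a : ∀ {t} → IsE a t → Meets t (a ˘ ⨾ a)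
    E-meets-a˘⨾a (_ , _ , a⨾t≡a) =
      Meets-⨾ˡ a˘˘≡a (subst (λ u → Meets u a) (sym a⨾t≡a) (Meets-refl a≢0))

    a˘-meets-a˘⨾S : ∀ {s} → IsS a s → Meets (a ˘) (a ˘ ⨾ s)
    a˘-meets-a˘⨾S isS = Meets-⨾ˡ a˘˘≡a (Meets-sym (S-meets-a⨾a˘ isS))

    a˘-meets-E⨾a˘ : ∀ {t} → IsE a t → Meets (a ˘) (t ⨾ a ˘)
    a˘-meets-E⨾a˘ isE = Meets-⨾ʳ a˘˘≡a (Meets-sym (E-meets-a˘⨾a isE))

  IsS-unique : ∀ {a e e'} → Atom a → IsS a e → IsS a e' → e ≡ e'
  IsS-unique {a} {e} {e'} ata (ate , e≤1' , e⨾a≡a) (ate' , e'≤1' , e'⨾a≡a) =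
    Atom-Meets⇒≡ ate ate' λ e·e'≡0 → proj₁ ata (begin
      a               ≡⟨ sym e⨾a≡a ⟩
      e ⨾ a           ≡⟨ cong (e ⨾_) (sym e'⨾a≡a) ⟩
      e ⨾ (e' ⨾ a)    ≡⟨ sym (⨾-assoc-subidˡ e' a e≤1') ⟩
      (e ⨾ e') ⨾ a    ≡⟨ cong (_⨾ a) (subid-disjoint⇒⨾≡0 e≤1' e'≤1' e·e'≡0) ⟩
      0r ⨾ a          ≡⟨ ⨾-zeroˡ a ⟩
      0r              ∎)

  IsE-unique : ∀ {a e e'} → Atom a → IsE a e → IsE a e' → e ≡ e'
  IsE-unique {a} {e} {e'} ata (ate , e≤1' , a⨾e≡a) (ate' , e'≤1' , a⨾e'≡a) =
    Atom-Meets⇒≡ ate ate' λ e·e'≡0 → proj₁ ata (begin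
      a               ≡⟨ sym a⨾e'≡a ⟩
      a ⨾ e'          ≡⟨ cong (_⨾ e') (sym a⨾e≡a) ⟩
      (a ⨾ e) ⨾ e'    ≡⟨ ⨾-assoc-subidʳ a e e'≤1' ⟩
      a ⨾ (e ⨾ e')    ≡⟨ cong (a ⨾_) (subid-disjoint⇒⨾≡0 e≤1' e'≤1' e·e'≡0) ⟩
      a ⨾ 0r          ≡⟨ ⨾-zeroʳ a ⟩
      0r              ∎)

  SubidAtom : Pred Carrier ℓ
  SubidAtom p = Atom p × p ≤ 1'

  IsS⇒SubidAtom : ∀ {a s} → IsS a s → SubidAtom s
  IsS⇒SubidAtom (ats , s≤1' , _) = ats , s≤1'

  IsE⇒SubidAtom : ∀ {a t} → IsE a t → SubidAtom t
  IsE⇒SubidAtom (att , t≤1' , _) = att , t≤1'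

  -- If p · 1 ˘ = 0 then p = p ⨾ p ≤ (- 1 ˘) ⨾ (- 1 ˘), which Ax8 makes disjoint from 1'.
  subid-idem⇒≤1˘ : ∀ {p} → SubidAtom p → p ⨾ p ≡ p → p ≤ 1r ˘
  subid-idem⇒≤1˘ {p} (atp , p≤1') p⨾p≡p = Atom-Meets⇒≤ atp λ p·1˘≡0 →
    let p≤-1˘ = x·y≡0⇒x≤-y p·1˘≡0
        p≤-1˘⨾-1˘ = subst (_≤ _) p⨾p≡p
          (≤-trans (⨾-monoˡ p p≤-1˘) (⨾-monoʳ (- (1r ˘)) p≤-1˘))
    in proj₁ atp (x≤0⇒x≡0 (subst (p ≤_) ax8 (·-greatest p≤-1˘⨾-1˘ p≤1')))

˘-CompletelyAdditive : ∀ {ℓ} → RelAlg ℓ → Set (lsuc ℓ)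
˘-CompletelyAdditive 𝔄 = ∀ X s → IsSup X s → IsSup (Img _˘ X) (s ˘)
  where open Theory 𝔄

module ConverseProperties {ℓ : Level} (𝔄 : RelAlg ℓ) (˘-additive : ˘-CompletelyAdditive 𝔄) where
  open Theory 𝔄
  open BooleanReduct 𝔄
  open ≡-Reasoning

  ˘-zero : 0r ˘ ≡ 0r
  ˘-zero = x≤0⇒x≡0 (proj₂ (˘-additive ∅ 0r ((λ _ ()) , λ u _ → 0≤x u)) 0r λ { _ (_ , () , _) })
    where
    ∅ : Pred Carrier ℓ
    ∅ _ = Lift ℓ ⊥

  ˘-mono : ∀ {x y} → x ≤ y → x ˘ ≤ y ˘
  ˘-mono {x} {y} x≤y =
    proj₁ (˘-additive X y (X≤y , λ _ below → below y (inj₂ refl))) (x ˘) (x , inj₁ refl , refl)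
    where
    X : Pred Carrier ℓ
    X z = z ≡ x ⊎ z ≡ y
    X≤y : ∀ z → X z → z ≤ y
    X≤y _ (inj₁ refl) = x≤y
    X≤y _ (inj₂ refl) = ≤-refl

  ≤1˘⇒˘˘≡ : ∀ {c} → c ≤ 1r ˘ → c ˘ ˘ ≡ c
  ≤1˘⇒˘˘≡ {c} c≤1˘ = begin
    c ˘ ˘             ≡⟨ cong _˘ (sym (∧-identityˡ (c ˘))) ⟩
    (1r · c ˘) ˘      ≡⟨ ax2 1r c ⟩
    1r ˘ · c          ≡⟨ ∧-comm (1r ˘) c ⟩
    c · 1r ˘          ≡⟨ sym (≤⇒≼ c≤1˘) ⟩
    c                 ∎

  Atom-≤1˘ : ∀ {a} → Atom a → a ˘ ≢ 0r → a ≤ 1r ˘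
  Atom-≤1˘ {a} ata a˘≢0 = Atom-Meets⇒≤ ata λ a·1˘≡0 → a˘≢0 (begin
    a ˘             ≡⟨ sym (∧-identityʳ (a ˘)) ⟩
    a ˘ · 1r        ≡⟨ sym (ax2 a 1r) ⟩
    (a · 1r ˘) ˘    ≡⟨ cong _˘ a·1˘≡0 ⟩
    0r ˘            ≡⟨ ˘-zero ⟩
    0r              ∎)

  Atom-˘˘ : ∀ {a} → Atom a → a ˘ ≢ 0r → a ˘ ˘ ≡ a
  Atom-˘˘ ata a˘≢0 = ≤1˘⇒˘˘≡ (Atom-≤1˘ ata a˘≢0)

  Atom-˘ : ∀ {a} → Atom a → a ˘ ≢ 0r → Atom (a ˘)
  Atom-˘ {a} ata a˘≢0 = a˘≢0 , below
    where
    ≤a˘⇒˘˘≡ : ∀ {b} → b ≤ a ˘ → b ˘ ˘ ≡ b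
    ≤a˘⇒˘˘≡ b≤a˘ = ≤1˘⇒˘˘≡ (≤-trans b≤a˘ (˘-mono (x≤1 a)))

    below : ∀ b → b ≤ a ˘ → b ≡ 0r ⊎ b ≡ a ˘
    below b b≤a˘ with proj₂ ata (b ˘) (subst (b ˘ ≤_) (Atom-˘˘ ata a˘≢0) (˘-mono b≤a˘))
    ... | inj₁ b˘≡0 = inj₁ (trans (sym (≤a˘⇒˘˘≡ b≤a˘)) (trans (cong _˘ b˘≡0) ˘-zero))
    ... | inj₂ b˘≡a = inj₂ (trans (sym (≤a˘⇒˘˘≡ b≤a˘)) (cong _˘ b˘≡a))

  Atom-˘˘≢0 : ∀ {a} → Atom a → a ˘ ≢ 0r → a ˘ ˘ ≢ 0r
  Atom-˘˘≢0 ata a˘≢0 = subst (_≢ 0r) (sym (Atom-˘˘ ata a˘≢0)) (proj₁ ata)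

module PerfectProperties {ℓ : Level} (em : ExcludedMiddle ℓ) (𝔄 : RelAlg ℓ)
  (perfect : Theory.Perfect 𝔄) where
  open Theory 𝔄
  open BooleanReduct 𝔄
  open RelAlgProperties 𝔄

  private
    atomic : Atomic
    atomic = proj₁ (proj₂ perfect)

    ˘-additive = proj₁ (proj₂ (proj₂ perfect))
    ⨾-additiveˡ = proj₁ (proj₂ (proj₂ (proj₂ perfect)))
    ⨾-additiveʳ = proj₂ (proj₂ (proj₂ (proj₂ perfect)))

  open ConverseProperties 𝔄 ˘-additive public

  Atom-below-sup : ∀ {X s b} → IsSup X s → Atom b → b ≤ s → ∃ λ x → X x × Meets b x
  Atom-below-sup {X} {s} {b} (_ , least) atb b≤s with em {∃ λ x → X x × Meets b x}
  ... | yes found = found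
  ... | no none = ⊥-elim (proj₁ atb (x≤y⇒x≤-y⇒x≡0 ≤-refl (≤-trans b≤s (least (- b) X≤-b))))
    where
    X≤-b : ∀ x → X x → x ≤ - b
    X≤-b x Xx with Atom-disjoint⊎≤ atb x
    ... | inj₁ b·x≡0 = x·y≡0⇒x≤-y (trans (∧-comm x b) b·x≡0)
    ... | inj₂ b≤x = ⊥-elim (none (x , Xx , ≤⇒Meets (proj₁ atb) b≤x))

  1'-isSup : IsSup SubidAtom 1'
  1'-isSup = (λ _ → proj₂) , least
    where
    least : ∀ u → (∀ q → SubidAtom q → q ≤ u) → 1' ≤ u
    least u bound with em {1' · (- u) ≡ 0r}
    ... | yes 1'·-u≡0 = x·-y≡0⇒x≤y 1'·-u≡0
    ... | no 1'·-u≢0 with atomic _ 1'·-u≢0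
    ... | b , atb , b≤1'·-u = ⊥-elim (proj₁ atb (x≤y⇒x≤-y⇒x≡0 b≤u b≤-u))
      where
      b≤u = bound b (atb , ≤-trans b≤1'·-u (x·y≤x 1' (- u)))
      b≤-u = ≤-trans b≤1'·-u (x·y≤y 1' (- u))

  Atom-below-st : ∀ {b} z → Atom b → b ≤ st z → ∃ λ q → SubidAtom q × Meets b (q ⨾ z)
  Atom-below-st z atb b≤st with Atom-below-sup (⨾-additiveˡ SubidAtom 1' z 1'-isSup) atb b≤st
  ... | _ , (q , subq , refl) , m = q , subq , m

  Atom-below-end : ∀ {b} z → Atom b → b ≤ end z → ∃ λ q → SubidAtom q × Meets b (z ⨾ q)
  Atom-below-end z atb b≤end with Atom-below-sup (⨾-additiveʳ SubidAtom 1' z 1'-isSup) atb b≤end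
  ... | _ , (q , subq , refl) , m = q , subq , m

  S-exists : ∀ {a} → Atom a → st a ≢ 0r → ∃ (IsS a)
  S-exists {a} ata st≢0 with atomic _ st≢0
  ... | b , atb , b≤st with Atom-below-st a atb b≤st
  ... | q , (atq , q≤1') , m = q , atq , q≤1' , Atom-≢0-≤⇒≡ ata (Meets⇒≢0 m) (subid-⨾ˡ a q≤1')

  E-exists : ∀ {a} → Atom a → end a ≢ 0r → ∃ (IsE a)
  E-exists {a} ata end≢0 with atomic _ end≢0
  ... | b , atb , b≤end with Atom-below-end a atb b≤end
  ... | q , (atq , q≤1') , m = q , atq , q≤1' , Atom-≢0-≤⇒≡ ata (Meets⇒≢0 m) (subid-⨾ʳ a q≤1')

  -- p ≤ 1' ⨾ 1' meets some q ⨾ 1' ≤ q, forcing q = p; then p ≤ p ⨾ 1'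
  -- meets some p ⨾ r ≤ r, forcing r = p.
  subid-idem : ∀ {p} → SubidAtom p → p ⨾ p ≡ p
  subid-idem {p} (atp , p≤1') = ≤-antisym (subid-⨾ʳ p p≤1') p≤p⨾p
    where
    p≤end-p : p ≤ end p
    p≤end-p with Atom-below-st 1' atp (subst (p ≤_) (sym ax7) p≤1')
    ... | q , (atq , _) , m = Atom-Meets⇒≤ atp (subst (λ t → Meets p (t ⨾ 1')) (sym p≡q) m)
      where p≡q = Atom-Meets⇒≡ atp atq (Meets-monoʳ m (ax6ʳ q))

    p≤p⨾p : p ≤ p ⨾ p
    p≤p⨾p with Atom-below-end p atp p≤end-p
    ... | r , (atr , _) , m = Atom-Meets⇒≤ atp (subst (λ t → Meets p (p ⨾ t)) (sym p≡r) m)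
      where p≡r = Atom-Meets⇒≡ atp atr (Meets-monoʳ m (subid-⨾ˡ r p≤1'))

  subid-˘ : ∀ {p} → SubidAtom p → p ˘ ≡ p
  subid-˘ {p} sp@(atp , p≤1') = sym (≤-antisym p≤p˘ (subst (p ˘ ≤_) p˘˘≡p (˘-mono p≤p˘)))
    where
    p˘˘≡p : p ˘ ˘ ≡ p
    p˘˘≡p = ≤1˘⇒˘˘≡ (subid-idem⇒≤1˘ sp (subid-idem sp))

    p≤p˘ : p ≤ p ˘
    p≤p˘ = Atom-Meets⇒≤ atp (Meets-monoʳ
      (Meets-⨾ʳ p˘˘≡p (subst (λ t → Meets t p) (sym (subid-idem sp)) (Meets-refl (proj₁ atp))))
      (subid-⨾ˡ (p ˘) p≤1'))

  subid-IsS : ∀ {p} → SubidAtom p → IsS p p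
  subid-IsS sp@(atp , p≤1') = atp , p≤1' , subid-idem sp

  subid-IsE : ∀ {p} → SubidAtom p → IsE p p
  subid-IsE sp@(atp , p≤1') = atp , p≤1' , subid-idem sp

  IsS-subid : ∀ {p l} → SubidAtom p → IsS p l → l ≡ p
  IsS-subid sp@(atp , _) isS = IsS-unique atp isS (subid-IsS sp)

  IsE-subid : ∀ {p l} → SubidAtom p → IsE p l → l ≡ p
  IsE-subid sp@(atp , _) isE = IsE-unique atp isE (subid-IsE sp)

  subid-st≢0 : ∀ {p} → SubidAtom p → st p ≢ 0r
  subid-st≢0 sp@(atp , p≤1') =
    ≢0-mono (proj₁ atp) (subst (_≤ st _) (subid-idem sp) (⨾-monoˡ _ p≤1'))

  subid-end≢0 : ∀ {p} → SubidAtom p → end p ≢ 0r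
  subid-end≢0 sp@(atp , p≤1') =
    ≢0-mono (proj₁ atp) (subst (_≤ end _) (subid-idem sp) (⨾-monoʳ _ p≤1'))

  subid-˘≢0 : ∀ {p} → SubidAtom p → p ˘ ≢ 0r
  subid-˘≢0 sp = subst (_≢ 0r) (sym (subid-˘ sp)) (proj₁ (proj₁ sp))

  module _ {a} (ata : Atom a) (a˘≢0 : a ˘ ≢ 0r) where
    private
      a˘˘≡a = Atom-˘˘ ata a˘≢0

    ˘≤1'⇔≤1' : a ˘ ≤ 1' ⇔ a ≤ 1'
    ˘≤1'⇔≤1' = mk⇔
      (λ a˘≤1' → subst (_≤ 1') (trans (sym (subid-˘ (Atom-˘ ata a˘≢0 , a˘≤1'))) a˘˘≡a) a˘≤1')
      (λ a≤1' → subst (_≤ 1') (sym (subid-˘ (ata , a≤1'))) a≤1')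

    st≢0⇒end˘≢0 : st a ≢ 0r → end (a ˘) ≢ 0r
    st≢0⇒end˘≢0 st≢0 with S-exists ata st≢0
    ... | s , isS@(_ , s≤1' , _) =
      Meets⇒≢0 (Meets-monoʳ (a˘-meets-a˘⨾S (proj₁ ata) a˘˘≡a isS) (⨾-monoʳ (a ˘) s≤1'))

    end≢0⇒st˘≢0 : end a ≢ 0r → st (a ˘) ≢ 0r
    end≢0⇒st˘≢0 end≢0 with E-exists ata end≢0
    ... | t , isE@(_ , t≤1' , _) =
      Meets⇒≢0 (Meets-monoʳ (a˘-meets-E⨾a˘ (proj₁ ata) a˘˘≡a isE) (⨾-monoˡ (a ˘) t≤1'))

  st˘≢0⇔end≢0 : ∀ {a} → Atom a → a ˘ ≢ 0r → st (a ˘) ≢ 0r ⇔ end a ≢ 0r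
  st˘≢0⇔end≢0 ata a˘≢0 = mk⇔
    (λ st˘≢0 → subst (λ t → end t ≢ 0r) (Atom-˘˘ ata a˘≢0)
      (st≢0⇒end˘≢0 (Atom-˘ ata a˘≢0) (Atom-˘˘≢0 ata a˘≢0) st˘≢0))
    (end≢0⇒st˘≢0 ata a˘≢0)

  end˘≢0⇔st≢0 : ∀ {a} → Atom a → a ˘ ≢ 0r → end (a ˘) ≢ 0r ⇔ st a ≢ 0r
  end˘≢0⇔st≢0 ata a˘≢0 = mk⇔
    (λ end˘≢0 → subst (λ t → st t ≢ 0r) (Atom-˘˘ ata a˘≢0)
      (end≢0⇒st˘≢0 (Atom-˘ ata a˘≢0) (Atom-˘˘≢0 ata a˘≢0) end˘≢0))
    (st≢0⇒end˘≢0 ata a˘≢0)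

module NetworkNa {ℓ : Level} (em : ExcludedMiddle ℓ) (𝔄 : RelAlg ℓ) (perfect : Theory.Perfect 𝔄)
  (a : RelAlg.Carrier 𝔄) (ata : Theory.Atom 𝔄 a) (V : Set ℓ) (x y : V)
  (cover : ∀ z → z ≡ x ⊎ z ≡ y) (x≡y⇔a≤1' : x ≡ y ⇔ RelAlg._≤_ 𝔄 a (RelAlg.1' 𝔄)) where
  open Theory 𝔄
  open BooleanReduct 𝔄
  open RelAlgProperties 𝔄
  open PerfectProperties em 𝔄 perfect
  open Equivalence

  R : V → V → Carrier → Set ℓ
  R = NSpec a x y

  Lxx Lyy Lyx : Carrier → Set ℓ
  Lxx l = st a ≢ 0r × IsS a l
  Lyy l = end a ≢ 0r × IsE a l
  Lyx l = a ˘ ≢ 0r × l ≡ a ˘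

  module Collapsed (x≡y : x ≡ y) where
    a-subid : SubidAtom a
    a-subid = ata , to x≡y⇔a≤1' x≡y

    label≡a : ∀ {u v l} → R u v l → l ≡ a
    label≡a (inj₁ (_ , _ , l≡a)) = l≡a
    label≡a (inj₂ (inj₁ (_ , _ , _ , isS))) = IsS-subid a-subid isS
    label≡a (inj₂ (inj₂ (inj₁ (_ , _ , _ , isE)))) = IsE-subid a-subid isE
    label≡a (inj₂ (inj₂ (inj₂ (_ , _ , _ , l≡a˘)))) = trans l≡a˘ (subid-˘ a-subid)

    Lxx-R : ∀ {u v l} → R u v l → Lxx l
    Lxx-R r = subid-st≢0 a-subid , subst (IsS a) (sym (label≡a r)) (subid-IsS a-subid)

    Lyy-R : ∀ {u v l} → R u v l → Lyy l
    Lyy-R r = subid-end≢0 a-subid , subst (IsE a) (sym (label≡a r)) (subid-IsE a-subid)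

    Lyx-R : ∀ {u v l} → R u v l → Lyx l
    Lyx-R r = subid-˘≢0 a-subid , trans (label≡a r) (sym (subid-˘ a-subid))

  R-xy : ∀ {l} → R x y l → l ≡ a
  R-xy (inj₁ (_ , _ , l≡a)) = l≡a
  R-xy r@(inj₂ (inj₁ (_ , _ , y≡x , _))) = Collapsed.label≡a (sym y≡x) r
  R-xy r@(inj₂ (inj₂ (inj₁ (_ , x≡y , _)))) = Collapsed.label≡a x≡y r
  R-xy r@(inj₂ (inj₂ (inj₂ (_ , x≡y , _)))) = Collapsed.label≡a x≡y r

  R-xx : ∀ {l} → R x x l → Lxx l
  R-xx r@(inj₁ (_ , x≡y , _)) = Collapsed.Lxx-R x≡y r
  R-xx (inj₂ (inj₁ (st≢0 , _ , _ , isS))) = st≢0 , isS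
  R-xx r@(inj₂ (inj₂ (inj₁ (_ , x≡y , _)))) = Collapsed.Lxx-R x≡y r
  R-xx r@(inj₂ (inj₂ (inj₂ (_ , x≡y , _)))) = Collapsed.Lxx-R x≡y r

  R-yy : ∀ {l} → R y y l → Lyy l
  R-yy r@(inj₁ (y≡x , _)) = Collapsed.Lyy-R (sym y≡x) r
  R-yy r@(inj₂ (inj₁ (_ , y≡x , _))) = Collapsed.Lyy-R (sym y≡x) r
  R-yy (inj₂ (inj₂ (inj₁ (end≢0 , _ , _ , isE)))) = end≢0 , isE
  R-yy r@(inj₂ (inj₂ (inj₂ (_ , _ , y≡x , _)))) = Collapsed.Lyy-R (sym y≡x) r

  R-yx : ∀ {l} → R y x l → Lyx l
  R-yx r@(inj₁ (y≡x , _)) = Collapsed.Lyx-R (sym y≡x) r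
  R-yx r@(inj₂ (inj₁ (_ , y≡x , _))) = Collapsed.Lyx-R (sym y≡x) r
  R-yx r@(inj₂ (inj₂ (inj₁ (_ , _ , x≡y , _)))) = Collapsed.Lyx-R x≡y r
  R-yx (inj₂ (inj₂ (inj₂ (a˘≢0 , _ , _ , l≡a˘)))) = a˘≢0 , l≡a˘

  R-functional : ∀ u v {l l'} → R u v l → R u v l' → l ≡ l'
  R-functional u v r r' with cover u | cover v
  ... | inj₁ refl | inj₁ refl = IsS-unique ata (proj₂ (R-xx r)) (proj₂ (R-xx r'))
  ... | inj₁ refl | inj₂ refl = trans (R-xy r) (sym (R-xy r'))
  ... | inj₂ refl | inj₁ refl = trans (proj₂ (R-yx r)) (sym (proj₂ (R-yx r')))
  ... | inj₂ refl | inj₂ refl = IsE-unique ata (proj₂ (R-yy r)) (proj₂ (R-yy r'))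

  ∃R-xy : ∃ (R x y)
  ∃R-xy = a , inj₁ (refl , refl , refl)

  ∃R-xx⇔st≢0 : ∃ (R x x) ⇔ st a ≢ 0r
  ∃R-xx⇔st≢0 = mk⇔ (λ (_ , r) → proj₁ (R-xx r)) λ st≢0 →
    map₂ (λ isS → inj₂ (inj₁ (st≢0 , refl , refl , isS))) (S-exists ata st≢0)

  ∃R-yy⇔end≢0 : ∃ (R y y) ⇔ end a ≢ 0r
  ∃R-yy⇔end≢0 = mk⇔ (λ (_ , r) → proj₁ (R-yy r)) λ end≢0 →
    map₂ (λ isE → inj₂ (inj₂ (inj₁ (end≢0 , refl , refl , isE)))) (E-exists ata end≢0)

  ∃R-yx⇔˘≢0 : ∃ (R y x) ⇔ a ˘ ≢ 0r
  ∃R-yx⇔˘≢0 = mk⇔ (λ (_ , r) → proj₁ (R-yx r)) λ a˘≢0 →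
    a ˘ , inj₂ (inj₂ (inj₂ (a˘≢0 , refl , refl , refl)))

  R-atom : ∀ {u v l} → R u v l → Atom l
  R-atom (inj₁ (_ , _ , refl)) = ata
  R-atom (inj₂ (inj₁ (_ , _ , _ , atl , _))) = atl
  R-atom (inj₂ (inj₂ (inj₁ (_ , _ , _ , atl , _)))) = atl
  R-atom (inj₂ (inj₂ (inj₂ (a˘≢0 , _ , _ , refl)))) = Atom-˘ ata a˘≢0

  N1-at : V → V → Carrier → Set ℓ
  N1-at u v l = (l ≤ 1' ⇔ u ≡ v) × (st l ≢ 0r ⇔ ∃ (R u u))
              × (end l ≢ 0r ⇔ ∃ (R v v)) × (l ˘ ≢ 0r ⇔ ∃ (R v u))

  loop-N1 : ∀ {u l} → SubidAtom l → R u u l → N1-at u u l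
  loop-N1 {l = l} sl@(_ , l≤1') r =
      mk⇔ (λ _ → refl) (λ _ → l≤1')
    , mk⇔ (λ _ → l , r) (λ _ → subid-st≢0 sl)
    , mk⇔ (λ _ → l , r) (λ _ → subid-end≢0 sl)
    , mk⇔ (λ _ → l , r) (λ _ → subid-˘≢0 sl)

  R-N1 : ∀ u v {l} → R u v l → N1-at u v l
  R-N1 u v r with cover u | cover v
  ... | inj₁ refl | inj₁ refl = loop-N1 (IsS⇒SubidAtom (proj₂ (R-xx r))) r
  ... | inj₂ refl | inj₂ refl = loop-N1 (IsE⇒SubidAtom (proj₂ (R-yy r))) r
  ... | inj₁ refl | inj₂ refl with R-xy r
  ...   | refl =
      ⇔.sym x≡y⇔a≤1' , ⇔.sym ∃R-xx⇔st≢0 , ⇔.sym ∃R-yy⇔end≢0 , ⇔.sym ∃R-yx⇔˘≢0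
  R-N1 u v r | inj₂ refl | inj₁ refl with R-yx r
  ...   | a˘≢0 , refl =
      ⇔.trans (˘≤1'⇔≤1' ata a˘≢0) (⇔.trans (⇔.sym x≡y⇔a≤1') (mk⇔ sym sym))
    , ⇔.trans (st˘≢0⇔end≢0 ata a˘≢0) (⇔.sym ∃R-yy⇔end≢0)
    , ⇔.trans (end˘≢0⇔st≢0 ata a˘≢0) (⇔.sym ∃R-xx⇔st≢0)
    , mk⇔ (λ _ → ∃R-xy) (λ _ → Atom-˘˘≢0 ata a˘≢0)

  loop-N2 : ∀ {l l'} → SubidAtom l → l' ≡ l → Meets l (l' ˘)
  loop-N2 sl refl = subst (Meets _) (sym (subid-˘ sl)) (Meets-refl (proj₁ (proj₁ sl)))

  R-N2 : ∀ u v {l l'} → R u v l → R v u l' → Meets l (l' ˘)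
  R-N2 u v r r' with cover u | cover v
  ... | inj₁ refl | inj₁ refl = let _ , isS = R-xx r in
    loop-N2 (IsS⇒SubidAtom isS) (IsS-unique ata (proj₂ (R-xx r')) isS)
  ... | inj₂ refl | inj₂ refl = let _ , isE = R-yy r in
    loop-N2 (IsE⇒SubidAtom isE) (IsE-unique ata (proj₂ (R-yy r')) isE)
  ... | inj₁ refl | inj₂ refl with R-xy r | R-yx r'
  ...   | refl | a˘≢0 , refl = subst (Meets a) (sym (Atom-˘˘ ata a˘≢0)) (Meets-refl (proj₁ ata))
  R-N2 u v r r' | inj₂ refl | inj₁ refl with R-yx r | R-xy r'
  ...   | a˘≢0 , refl | refl = Meets-refl a˘≢0

  loop-N3 : ∀ {l m n} → SubidAtom l → m ≡ l → n ≡ l → Meets l (m ⨾ n)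
  loop-N3 sl refl refl = subst (Meets _) (sym (subid-idem sl)) (Meets-refl (proj₁ (proj₁ sl)))

  R-N3 : ∀ u v w {l m n} → R u v l → R u w m → R w v n → Meets l (m ⨾ n)
  R-N3 u v w r₁ r₂ r₃ with cover u | cover v | cover w
  ... | inj₁ refl | inj₁ refl | inj₁ refl = let _ , isS = R-xx r₁ in
    loop-N3 (IsS⇒SubidAtom isS)
      (IsS-unique ata (proj₂ (R-xx r₂)) isS) (IsS-unique ata (proj₂ (R-xx r₃)) isS)
  ... | inj₂ refl | inj₂ refl | inj₂ refl = let _ , isE = R-yy r₁ in
    loop-N3 (IsE⇒SubidAtom isE)
      (IsE-unique ata (proj₂ (R-yy r₂)) isE) (IsE-unique ata (proj₂ (R-yy r₃)) isE)
  ... | inj₁ refl | inj₂ refl | inj₁ refl with R-xy r₁ | R-xx r₂ | R-xy r₃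
  ...   | refl | _ , _ , _ , m⨾a≡a | refl = subst (Meets a) (sym m⨾a≡a) (Meets-refl (proj₁ ata))
  R-N3 u v w r₁ r₂ r₃ | inj₁ refl | inj₂ refl | inj₂ refl with R-xy r₁ | R-xy r₂ | R-yy r₃
  ...   | refl | refl | _ , _ , _ , a⨾n≡a = subst (Meets a) (sym a⨾n≡a) (Meets-refl (proj₁ ata))
  R-N3 u v w r₁ r₂ r₃ | inj₁ refl | inj₁ refl | inj₂ refl with R-xx r₁ | R-xy r₂ | R-yx r₃
  ...   | _ , isS | refl | a˘≢0 , refl = S-meets-a⨾a˘ (proj₁ ata) (Atom-˘˘ ata a˘≢0) isS
  R-N3 u v w r₁ r₂ r₃ | inj₂ refl | inj₂ refl | inj₁ refl with R-yy r₁ | R-yx r₂ | R-xy r₃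
  ...   | _ , isE | a˘≢0 , refl | refl = E-meets-a˘⨾a (proj₁ ata) (Atom-˘˘ ata a˘≢0) isE
  R-N3 u v w r₁ r₂ r₃ | inj₂ refl | inj₁ refl | inj₁ refl with R-yx r₁ | R-yx r₂ | R-xx r₃
  ...   | a˘≢0 , refl | _ , refl | _ , isS = a˘-meets-a˘⨾S (proj₁ ata) (Atom-˘˘ ata a˘≢0) isS
  R-N3 u v w r₁ r₂ r₃ | inj₂ refl | inj₁ refl | inj₂ refl with R-yx r₁ | R-yy r₂ | R-yx r₃
  ...   | a˘≢0 , refl | _ , isE | _ , refl = a˘-meets-E⨾a˘ (proj₁ ata) (Atom-˘˘ ata a˘≢0) isE

  lab : V → V → Maybe Carrier
  lab u v = proj₁ (unique-choice em (R u v) (R-functional u v))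

  lab-spec : ∀ u v l → lab u v ≡ just l ⇔ R u v l
  lab-spec u v = proj₂ (unique-choice em (R u v) (R-functional u v))

  Edge⇔∃R : ∀ u v → Edge lab u v ⇔ ∃ (R u v)
  Edge⇔∃R u v =
    mk⇔ (λ (l , e) → l , to (lab-spec u v l) e) (λ (l , r) → l , from (lab-spec u v l) r)

  lab-isNetwork : IsNetwork lab
  lab-isNetwork = (λ u v l e → R-atom (R-of e)) , n1 , n2 , n3
    where
    R-of : ∀ {u v l} → lab u v ≡ just l → R u v l
    R-of {u} {v} {l} = to (lab-spec u v l)

    n1 : N1 lab
    n1 u v l e = let ≤1'⇔ , st⇔ , end⇔ , ˘⇔ = R-N1 u v (R-of e) in
        ≤1'⇔
      , ⇔.trans st⇔ (⇔.sym (Edge⇔∃R u u))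
      , ⇔.trans end⇔ (⇔.sym (Edge⇔∃R v v))
      , ⇔.trans ˘⇔ (⇔.sym (Edge⇔∃R v u))

    n2 : N2 lab
    n2 u v _ _ e e' = R-N2 u v (R-of e) (R-of e')

    n3 : N3 lab
    n3 u v w _ _ _ e₁ e₂ e₃ = R-N3 u v w (R-of e₁) (R-of e₂) (R-of e₃)

lemma3p3 : ∀ {ℓ : Level} → ExcludedMiddle ℓ →
    (𝔄 : RelAlg ℓ) → let open Theory 𝔄 in
    Perfect → (a : Carrier) → Atom a →
    (V : Set ℓ) (x y : V) → (∀ z → z ≡ x ⊎ z ≡ y) → (x ≡ y ⇔ a ≤ 1') →
    ∃ λ (lab : V → V → Maybe Carrier) →
      (∀ u v l → (lab u v ≡ just l ⇔ NSpec a x y u v l)) × IsNetwork lab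
lemma3p3 em 𝔄 perfect a ata V x y cover x≡y⇔a≤1' = lab , lab-spec , lab-isNetwork
  where open NetworkNa em 𝔄 perfect a ata V x y cover x≡y⇔a≤1'
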